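{- Consider the signature $\Sigma_U=\{0,-,\mathrm{app},+,\cdot\}$ where $0$ is a constant, $-$ is unary minus, $\mathrm{app}$ is a unary function symbol (unary append, written postfix as $x1$ in the paper, semantically $x+1$), and $+,\cdot$ are binary. Let $N_2$ be the term rewriting system over $\Sigma_U\setminus\{ -\}$ given by the left-to-right oriented equations [U1] $x+0=x$; [U2$'$] $x+\mathrm{app}(y)=\mathrm{app}(x+y)$; [U3] $x\cdot 0=0$; [U4$'$] $x\cdot\mathrm{app}(y)=(x\cdot y)+x$, and let $Z_2$ be the term rewriting system over $\Sigma_U$ consisting of these four rules together with [U5] $-0=0$; [U6] $\mathrm{app}(-\mathrm{app}(x))=-x$; [U7] $-(-x)=x$; [U8] $x+(-y)=-((-x)+y)$; [U9] $x\cdot(-y)=-(x\cdot y)$. Then $N_2$ and $Z_2$ are ground-complete.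
   Context: Equations are read as rewrite rules from left to right with variables $x,y$. A term rewriting system is ground-complete if it is strongly terminating (no infinite rewrite sequences) and ground-confluent (confluent on closed terms). -}

module Defs where

open import Data.Nat using (ℕ)
open import Data.Empty using (⊥)
open import Data.Product using (_×_; ∃-syntax)
open import Induction.WellFounded using (WellFounded)
open import Relation.Binary.Construct.Closure.ReflexiveTransitive using (Star)

-- The two signatures: N = Σ_U \ {-},  Z = Σ_U.
data Sig : Set where
  N Z : Sig

data Term (V : Set) : Sig → Set where
  var   : ∀ {s} → V → Term V s
  zero  : ∀ {s} → Term V s
  app   : ∀ {s} → Term V s → Term V s
  _⊕_   : ∀ {s} → Term V s → Term V s → Term V s
  _⊗_   : ∀ {s} → Term V s → Term V s → Term V s
  neg   : Term V Z → Term V Z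

infixl 6 _⊕_
infixl 7 _⊗_

-- Root rewrite rules (all substitution instances of the oriented equations).
-- Over N only U1,U2',U3,U4' exist (system N2); over Z all nine (system Z2).
data Rule {V : Set} : ∀ {s} → Term V s → Term V s → Set where
  U1  : ∀ {s} {x : Term V s}   → Rule (x ⊕ zero) x
  U2' : ∀ {s} {x y : Term V s} → Rule (x ⊕ app y) (app (x ⊕ y))
  U3  : ∀ {s} {x : Term V s}   → Rule (x ⊗ zero) zero
  U4' : ∀ {s} {x y : Term V s} → Rule (x ⊗ app y) ((x ⊗ y) ⊕ x)
  U5  : Rule (neg zero) zero
  U6  : ∀ {x : Term V Z}   → Rule (app (neg (app x))) (neg x)
  U7  : ∀ {x : Term V Z}   → Rule (neg (neg x)) x
  U8  : ∀ {x y : Term V Z} → Rule (x ⊕ neg y) (neg (neg x ⊕ y))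
  U9  : ∀ {x y : Term V Z} → Rule (x ⊗ neg y) (neg (x ⊗ y))

data _⟶_ {V : Set} : ∀ {s} → Term V s → Term V s → Set where
  root : ∀ {s} {t u : Term V s} → Rule t u → t ⟶ u
  appC : ∀ {s} {t u : Term V s} → t ⟶ u → app t ⟶ app u
  ⊕ˡ   : ∀ {s} {t u w : Term V s} → t ⟶ u → (t ⊕ w) ⟶ (u ⊕ w)
  ⊕ʳ   : ∀ {s} {t u w : Term V s} → t ⟶ u → (w ⊕ t) ⟶ (w ⊕ u)
  ⊗ˡ   : ∀ {s} {t u w : Term V s} → t ⟶ u → (t ⊗ w) ⟶ (u ⊗ w)
  ⊗ʳ   : ∀ {s} {t u w : Term V s} → t ⟶ u → (w ⊗ t) ⟶ (w ⊗ u)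
  negC : {t u : Term V Z} → t ⟶ u → neg t ⟶ neg u

infix 4 _⟶_ _⟶*_ _⟵_

_⟶*_ : ∀ {V s} → Term V s → Term V s → Set
_⟶*_ = Star _⟶_

_⟵_ : ∀ {V s} → Term V s → Term V s → Set
t ⟵ u = u ⟶ t

StronglyTerminating : Sig → Set
StronglyTerminating s = WellFounded (_⟵_ {ℕ} {s})

GroundConfluent : Sig → Set
GroundConfluent s = ∀ {t u v : Term ⊥ s} → t ⟶* u → t ⟶* v →
  ∃[ w ] (u ⟶* w × v ⟶* w)

GroundComplete : Sig → Set
GroundComplete s = StronglyTerminating s × GroundConfluent s

-- Both systems are proved terminating by one polynomial interpretation into ℕ (append and
-- minus add 1, x + y ↦ x + 3y, x · y ↦ 4xy), under which every rule instance strictly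
-- decreases. For ground confluence, closed terms are evaluated in ℕ (for N₂) and ℤ (for Z₂):
-- every rule preserves the value, and every closed term rewrites to the numeral of its value
-- (0, 0 1, 0 1 1, … and their negations), so any two reducts of a term share that numeral.
module Submission where

open import Defs
open import Data.Empty using (⊥)
open import Data.Product using (_×_; _,_)
open import Data.Nat as ℕ using (ℕ; suc; _<_; NonZero; z<s; s<s; >-nonZero; >-nonZero⁻¹)
open import Data.Nat.Properties
  using ( m<m+n; n<1+n; m<n⇒m<1+n; ≤-trans; m≤m+n; m*n≢0; +-monoˡ-<; +-monoʳ-<; *-monoˡ-<; *-monoʳ-<
        ; +-identityʳ; +-suc; +-comm; *-zeroʳ; *-suc )
open import Data.Nat.Induction using (<-wellFounded)
import Data.Nat.Tactic.RingSolver as ℕ-Ring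
open import Data.Integer as ℤ using (ℤ; +_; -[1+_]; 1ℤ)
import Data.Integer.Properties as ℤ
import Data.Integer.Tactic.RingSolver as ℤ-Ring
open import Induction.WellFounded using (module Subrelation)
import Relation.Binary.Construct.On as On
open import Relation.Binary.Construct.Closure.ReflexiveTransitive using (ε; _◅_; _◅◅_; gmap; fold)
open import Relation.Binary.Construct.Closure.ReflexiveTransitive.Properties using (module StarReasoning)
open import Relation.Binary.PropositionalEquality using (_≡_; refl; sym; trans; cong; subst)

weight : ∀ {V s} → Term V s → ℕ
weight (var _) = 1
weight zero = 1
weight (app t) = suc (weight t)
weight (neg t) = suc (weight t)
weight (t ⊕ u) = weight t ℕ.+ 3 ℕ.* weight u
weight (t ⊗ u) = 4 ℕ.* weight t ℕ.* weight u

weight-nonZero : ∀ {V s} (t : Term V s) → NonZero (weight t)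
weight-nonZero (var _) = _
weight-nonZero zero = _
weight-nonZero (app t) = _
weight-nonZero (neg t) = _
weight-nonZero (t ⊕ u) =
  >-nonZero (≤-trans (>-nonZero⁻¹ (weight t) {{weight-nonZero t}}) (m≤m+n _ _))
weight-nonZero (t ⊗ u) =
  m*n≢0 (4 ℕ.* weight t) (weight u) {{m*n≢0 4 (weight t) {{_}} {{weight-nonZero t}}}} {{weight-nonZero u}}

m+[1+d]≡n⇒m<n : ∀ {m n} d → m ℕ.+ suc d ≡ n → m < n
m+[1+d]≡n⇒m<n {m} d refl = m<m+n m z<s

rule-decreases-weight : ∀ {V s} {t u : Term V s} → Rule t u → weight u < weight t
rule-decreases-weight {t = x ⊕ zero} U1 = m<m+n (weight x) z<s
rule-decreases-weight {t = x ⊕ app y} U2' = m+[1+d]≡n⇒m<n 1 (U2'-weight (weight x) (weight y))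
  where
  U2'-weight : ∀ a b → suc (a ℕ.+ 3 ℕ.* b) ℕ.+ 2 ≡ a ℕ.+ 3 ℕ.* suc b
  U2'-weight = ℕ-Ring.solve-∀
rule-decreases-weight {t = x ⊗ zero} U3 = U3-weight (weight x) {{weight-nonZero x}}
  where
  U3-weight : ∀ a .{{_ : NonZero a}} → 1 < 4 ℕ.* a ℕ.* 1
  U3-weight (suc a) = m+[1+d]≡n⇒m<n (2 ℕ.+ 4 ℕ.* a) (identity a)
    where
    identity : ∀ a → 1 ℕ.+ (3 ℕ.+ 4 ℕ.* a) ≡ 4 ℕ.* suc a ℕ.* 1
    identity = ℕ-Ring.solve-∀
rule-decreases-weight {t = x ⊗ app y} U4' = U4'-weight (weight x) (weight y) {{weight-nonZero x}}
  where
  U4'-weight : ∀ a b .{{_ : NonZero a}} → 4 ℕ.* a ℕ.* b ℕ.+ 3 ℕ.* a < 4 ℕ.* a ℕ.* suc b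
  U4'-weight (suc a) b = m+[1+d]≡n⇒m<n a (identity a b)
    where
    identity : ∀ a b → 4 ℕ.* suc a ℕ.* b ℕ.+ 3 ℕ.* suc a ℕ.+ suc a ≡ 4 ℕ.* suc a ℕ.* suc b
    identity = ℕ-Ring.solve-∀
rule-decreases-weight U5 = n<1+n 1
rule-decreases-weight {t = app (neg (app x))} U6 = s<s (m<n⇒m<1+n (n<1+n (weight x)))
rule-decreases-weight {t = neg (neg x)} U7 = m<n⇒m<1+n (n<1+n (weight x))
rule-decreases-weight {t = x ⊕ neg y} U8 = m+[1+d]≡n⇒m<n 0 (U8-weight (weight x) (weight y))
  where
  U8-weight : ∀ a b → suc (suc a ℕ.+ 3 ℕ.* b) ℕ.+ 1 ≡ a ℕ.+ 3 ℕ.* suc b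
  U8-weight = ℕ-Ring.solve-∀
rule-decreases-weight {t = x ⊗ neg y} U9 = U9-weight (weight x) (weight y) {{weight-nonZero x}}
  where
  U9-weight : ∀ a b .{{_ : NonZero a}} → suc (4 ℕ.* a ℕ.* b) < 4 ℕ.* a ℕ.* suc b
  U9-weight (suc a) b = m+[1+d]≡n⇒m<n (2 ℕ.+ 4 ℕ.* a) (identity a b)
    where
    identity : ∀ a b → suc (4 ℕ.* suc a ℕ.* b) ℕ.+ (3 ℕ.+ 4 ℕ.* a) ≡ 4 ℕ.* suc a ℕ.* suc b
    identity = ℕ-Ring.solve-∀

step-decreases-weight : ∀ {V s} {t u : Term V s} → t ⟶ u → weight u < weight t
step-decreases-weight (root r) = rule-decreases-weight r
step-decreases-weight (appC p) = s<s (step-decreases-weight p)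
step-decreases-weight (negC p) = s<s (step-decreases-weight p)
step-decreases-weight (⊕ˡ {w = w} p) = +-monoˡ-< (3 ℕ.* weight w) (step-decreases-weight p)
step-decreases-weight (⊕ʳ {w = w} p) =
  +-monoʳ-< (weight w) (*-monoʳ-< 3 (step-decreases-weight p))
step-decreases-weight (⊗ˡ {w = w} p) =
  *-monoˡ-< (weight w) {{weight-nonZero w}} (*-monoʳ-< 4 (step-decreases-weight p))
step-decreases-weight (⊗ʳ {w = w} p) =
  *-monoʳ-< (4 ℕ.* weight w) {{m*n≢0 4 (weight w) {{_}} {{weight-nonZero w}}}} (step-decreases-weight p)

stronglyTerminating : ∀ s → StronglyTerminating s
stronglyTerminating s =
  Subrelation.wellFounded step-decreases-weight (On.wellFounded weight <-wellFounded)

groundConfluent-by-evaluation : ∀ {s} {A : Set} (⟦_⟧ : Term ⊥ s → A) (normalForm : A → Term ⊥ s) →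
  (∀ {t u} → t ⟶ u → ⟦ t ⟧ ≡ ⟦ u ⟧) → (∀ t → t ⟶* normalForm ⟦ t ⟧) → GroundConfluent s
groundConfluent-by-evaluation ⟦_⟧ normalForm step-preserves normalises {t} t⟶*u t⟶*v =
  normalForm ⟦ t ⟧ , reaches-normalForm t⟶*u , reaches-normalForm t⟶*v
  where
  reaches-normalForm : ∀ {u} → t ⟶* u → u ⟶* normalForm ⟦ t ⟧
  reaches-normalForm {u} t⟶*u =
    subst (λ a → u ⟶* normalForm a) (sym (fold _≡_ trans refl (gmap ⟦_⟧ step-preserves t⟶*u))) (normalises u)

⊕-cong* : ∀ {V s} {t t′ u u′ : Term V s} → t ⟶* t′ → u ⟶* u′ → t ⊕ u ⟶* t′ ⊕ u′
⊕-cong* t⟶*t′ u⟶*u′ = gmap _ ⊕ˡ t⟶*t′ ◅◅ gmap _ ⊕ʳ u⟶*u′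

⊗-cong* : ∀ {V s} {t t′ u u′ : Term V s} → t ⟶* t′ → u ⟶* u′ → t ⊗ u ⟶* t′ ⊗ u′
⊗-cong* t⟶*t′ u⟶*u′ = gmap _ ⊗ˡ t⟶*t′ ◅◅ gmap _ ⊗ʳ u⟶*u′

numeral : ∀ {V s} → ℕ → Term V s
numeral 0 = zero
numeral (suc n) = app (numeral n)

numeral-+ : ∀ {V s} m n → numeral m ⊕ numeral n ⟶* numeral {V} {s} (m ℕ.+ n)
numeral-+ m 0 = begin
  numeral m ⊕ zero ⟶⟨ root U1 ⟩
  numeral m        ≡⟨ cong numeral (sym (+-identityʳ m)) ⟩
  numeral (m ℕ.+ 0) ∎
  where open StarReasoning _⟶_
numeral-+ m (suc n) = begin
  numeral m ⊕ app (numeral n) ⟶⟨ root U2' ⟩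
  app (numeral m ⊕ numeral n) ⟶*⟨ gmap app appC (numeral-+ m n) ⟩
  app (numeral (m ℕ.+ n))     ≡⟨ cong numeral (sym (+-suc m n)) ⟩
  numeral (m ℕ.+ suc n)       ∎
  where open StarReasoning _⟶_

numeral-* : ∀ {V s} m n → numeral m ⊗ numeral n ⟶* numeral {V} {s} (m ℕ.* n)
numeral-* m 0 = begin
  numeral m ⊗ zero ⟶⟨ root U3 ⟩
  zero             ≡⟨ cong numeral (sym (*-zeroʳ m)) ⟩
  numeral (m ℕ.* 0) ∎
  where open StarReasoning _⟶_
numeral-* m (suc n) = begin
  numeral m ⊗ app (numeral n)       ⟶⟨ root U4' ⟩
  numeral m ⊗ numeral n ⊕ numeral m ⟶*⟨ ⊕-cong* (numeral-* m n) ε ⟩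
  numeral (m ℕ.* n) ⊕ numeral m     ⟶*⟨ numeral-+ (m ℕ.* n) m ⟩
  numeral (m ℕ.* n ℕ.+ m)           ≡⟨ cong numeral (trans (+-comm (m ℕ.* n) m) (sym (*-suc m n))) ⟩
  numeral (m ℕ.* suc n)             ∎
  where open StarReasoning _⟶_

evalℕ : Term ⊥ N → ℕ
evalℕ zero = 0
evalℕ (app t) = suc (evalℕ t)
evalℕ (t ⊕ u) = evalℕ t ℕ.+ evalℕ u
evalℕ (t ⊗ u) = evalℕ t ℕ.* evalℕ u

evalℕ-rule : ∀ {t u} → Rule t u → evalℕ t ≡ evalℕ u
evalℕ-rule {x ⊕ zero} U1 = +-identityʳ (evalℕ x)
evalℕ-rule {x ⊕ app y} U2' = +-suc (evalℕ x) (evalℕ y)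
evalℕ-rule {x ⊗ zero} U3 = *-zeroʳ (evalℕ x)
evalℕ-rule {x ⊗ app y} U4' = trans (*-suc (evalℕ x) (evalℕ y)) (+-comm (evalℕ x) _)

evalℕ-step : ∀ {t u} → t ⟶ u → evalℕ t ≡ evalℕ u
evalℕ-step (root r) = evalℕ-rule r
evalℕ-step (appC p) = cong suc (evalℕ-step p)
evalℕ-step (⊕ˡ {w = w} p) = cong (ℕ._+ evalℕ w) (evalℕ-step p)
evalℕ-step (⊕ʳ {w = w} p) = cong (evalℕ w ℕ.+_) (evalℕ-step p)
evalℕ-step (⊗ˡ {w = w} p) = cong (ℕ._* evalℕ w) (evalℕ-step p)
evalℕ-step (⊗ʳ {w = w} p) = cong (evalℕ w ℕ.*_) (evalℕ-step p)

⟶*-numeral-evalℕ : ∀ t → t ⟶* numeral (evalℕ t)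
⟶*-numeral-evalℕ zero = ε
⟶*-numeral-evalℕ (app t) = gmap app appC (⟶*-numeral-evalℕ t)
⟶*-numeral-evalℕ (t ⊕ u) = ⊕-cong* (⟶*-numeral-evalℕ t) (⟶*-numeral-evalℕ u) ◅◅ numeral-+ _ _
⟶*-numeral-evalℕ (t ⊗ u) = ⊗-cong* (⟶*-numeral-evalℕ t) (⟶*-numeral-evalℕ u) ◅◅ numeral-* _ _

numeralℤ : ∀ {V} → ℤ → Term V Z
numeralℤ (+ n) = numeral n
numeralℤ -[1+ n ] = neg (numeral (suc n))

i+[1+j]≡1+[i+j] : ∀ i j → i ℤ.+ (1ℤ ℤ.+ j) ≡ 1ℤ ℤ.+ (i ℤ.+ j)
i+[1+j]≡1+[i+j] = ℤ-Ring.solve-∀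

i*[1+j]≡i*j+i : ∀ i j → i ℤ.* (1ℤ ℤ.+ j) ≡ i ℤ.* j ℤ.+ i
i*[1+j]≡i*j+i = ℤ-Ring.solve-∀

1-[1+i]≡-i : ∀ i → 1ℤ ℤ.+ ℤ.- (1ℤ ℤ.+ i) ≡ ℤ.- i
1-[1+i]≡-i = ℤ-Ring.solve-∀

i-j≡-[-i+j] : ∀ i j → i ℤ.- j ≡ ℤ.- (ℤ.- i ℤ.+ j)
i-j≡-[-i+j] = ℤ-Ring.solve-∀

app-numeralℤ : ∀ {V} i → app (numeralℤ {V} i) ⟶* numeralℤ (ℤ.suc i)
app-numeralℤ (+ n) = ε
app-numeralℤ -[1+ 0 ] = root U6 ◅ root U5 ◅ ε
app-numeralℤ -[1+ suc n ] = root U6 ◅ ε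

neg-numeralℤ : ∀ {V} i → neg (numeralℤ {V} i) ⟶* numeralℤ (ℤ.- i)
neg-numeralℤ (+ 0) = root U5 ◅ ε
neg-numeralℤ (+ suc n) = ε
neg-numeralℤ -[1+ n ] = root U7 ◅ ε

numeralℤ-+-numeral : ∀ {V} i n → numeralℤ {V} i ⊕ numeral n ⟶* numeralℤ (i ℤ.+ + n)
numeralℤ-+-numeral i 0 = begin
  numeralℤ i ⊕ zero    ⟶⟨ root U1 ⟩
  numeralℤ i           ≡⟨ cong numeralℤ (sym (ℤ.+-identityʳ i)) ⟩
  numeralℤ (i ℤ.+ + 0) ∎
  where open StarReasoning _⟶_
numeralℤ-+-numeral i (suc n) = begin
  numeralℤ i ⊕ app (numeral n)     ⟶⟨ root U2' ⟩
  app (numeralℤ i ⊕ numeral n)     ⟶*⟨ gmap app appC (numeralℤ-+-numeral i n) ⟩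
  app (numeralℤ (i ℤ.+ + n))       ⟶*⟨ app-numeralℤ (i ℤ.+ + n) ⟩
  numeralℤ (ℤ.suc (i ℤ.+ + n))     ≡⟨ cong numeralℤ (sym (i+[1+j]≡1+[i+j] i (+ n))) ⟩
  numeralℤ (i ℤ.+ + suc n)         ∎
  where open StarReasoning _⟶_

numeralℤ-+ : ∀ {V} i j → numeralℤ {V} i ⊕ numeralℤ j ⟶* numeralℤ (i ℤ.+ j)
numeralℤ-+ i (+ n) = numeralℤ-+-numeral i n
numeralℤ-+ i -[1+ n ] = begin
  numeralℤ i ⊕ neg (numeral (suc n))          ⟶⟨ root U8 ⟩
  neg (neg (numeralℤ i) ⊕ numeral (suc n))    ⟶*⟨ gmap neg negC (⊕-cong* (neg-numeralℤ i) ε) ⟩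
  neg (numeralℤ (ℤ.- i) ⊕ numeral (suc n))    ⟶*⟨ gmap neg negC (numeralℤ-+-numeral (ℤ.- i) (suc n)) ⟩
  neg (numeralℤ (ℤ.- i ℤ.+ + suc n))          ⟶*⟨ neg-numeralℤ (ℤ.- i ℤ.+ + suc n) ⟩
  numeralℤ (ℤ.- (ℤ.- i ℤ.+ + suc n))          ≡⟨ cong numeralℤ (sym (i-j≡-[-i+j] i (+ suc n))) ⟩
  numeralℤ (i ℤ.+ -[1+ n ])                   ∎
  where open StarReasoning _⟶_

numeralℤ-*-numeral : ∀ {V} i n → numeralℤ {V} i ⊗ numeral n ⟶* numeralℤ (i ℤ.* + n)
numeralℤ-*-numeral i 0 = begin
  numeralℤ i ⊗ zero    ⟶⟨ root U3 ⟩
  zero                 ≡⟨ cong numeralℤ (sym (ℤ.*-zeroʳ i)) ⟩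
  numeralℤ (i ℤ.* + 0) ∎
  where open StarReasoning _⟶_
numeralℤ-*-numeral i (suc n) = begin
  numeralℤ i ⊗ app (numeral n)             ⟶⟨ root U4' ⟩
  numeralℤ i ⊗ numeral n ⊕ numeralℤ i      ⟶*⟨ ⊕-cong* (numeralℤ-*-numeral i n) ε ⟩
  numeralℤ (i ℤ.* + n) ⊕ numeralℤ i        ⟶*⟨ numeralℤ-+ (i ℤ.* + n) i ⟩
  numeralℤ (i ℤ.* + n ℤ.+ i)               ≡⟨ cong numeralℤ (sym (i*[1+j]≡i*j+i i (+ n))) ⟩
  numeralℤ (i ℤ.* + suc n)                 ∎
  where open StarReasoning _⟶_

numeralℤ-* : ∀ {V} i j → numeralℤ {V} i ⊗ numeralℤ j ⟶* numeralℤ (i ℤ.* j)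
numeralℤ-* i (+ n) = numeralℤ-*-numeral i n
numeralℤ-* i -[1+ n ] = begin
  numeralℤ i ⊗ neg (numeral (suc n))     ⟶⟨ root U9 ⟩
  neg (numeralℤ i ⊗ numeral (suc n))     ⟶*⟨ gmap neg negC (numeralℤ-*-numeral i (suc n)) ⟩
  neg (numeralℤ (i ℤ.* + suc n))         ⟶*⟨ neg-numeralℤ (i ℤ.* + suc n) ⟩
  numeralℤ (ℤ.- (i ℤ.* + suc n))         ≡⟨ cong numeralℤ (ℤ.neg-distribʳ-* i (+ suc n)) ⟩
  numeralℤ (i ℤ.* -[1+ n ])              ∎
  where open StarReasoning _⟶_

evalℤ : Term ⊥ Z → ℤ
evalℤ zero = + 0
evalℤ (app t) = ℤ.suc (evalℤ t)
evalℤ (neg t) = ℤ.- evalℤ t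
evalℤ (t ⊕ u) = evalℤ t ℤ.+ evalℤ u
evalℤ (t ⊗ u) = evalℤ t ℤ.* evalℤ u

evalℤ-rule : ∀ {t u} → Rule t u → evalℤ t ≡ evalℤ u
evalℤ-rule {x ⊕ zero} U1 = ℤ.+-identityʳ (evalℤ x)
evalℤ-rule {x ⊕ app y} U2' = i+[1+j]≡1+[i+j] (evalℤ x) (evalℤ y)
evalℤ-rule {x ⊗ zero} U3 = ℤ.*-zeroʳ (evalℤ x)
evalℤ-rule {x ⊗ app y} U4' = i*[1+j]≡i*j+i (evalℤ x) (evalℤ y)
evalℤ-rule U5 = refl
evalℤ-rule {app (neg (app x))} U6 = 1-[1+i]≡-i (evalℤ x)
evalℤ-rule {neg (neg x)} U7 = ℤ.neg-involutive (evalℤ x)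
evalℤ-rule {x ⊕ neg y} U8 = i-j≡-[-i+j] (evalℤ x) (evalℤ y)
evalℤ-rule {x ⊗ neg y} U9 = sym (ℤ.neg-distribʳ-* (evalℤ x) (evalℤ y))

evalℤ-step : ∀ {t u} → t ⟶ u → evalℤ t ≡ evalℤ u
evalℤ-step (root r) = evalℤ-rule r
evalℤ-step (appC p) = cong ℤ.suc (evalℤ-step p)
evalℤ-step (negC p) = cong ℤ.-_ (evalℤ-step p)
evalℤ-step (⊕ˡ {w = w} p) = cong (ℤ._+ evalℤ w) (evalℤ-step p)
evalℤ-step (⊕ʳ {w = w} p) = cong (ℤ._+_ (evalℤ w)) (evalℤ-step p)
evalℤ-step (⊗ˡ {w = w} p) = cong (ℤ._* evalℤ w) (evalℤ-step p)
evalℤ-step (⊗ʳ {w = w} p) = cong (evalℤ w ℤ.*_) (evalℤ-step p)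

⟶*-numeralℤ-evalℤ : ∀ t → t ⟶* numeralℤ (evalℤ t)
⟶*-numeralℤ-evalℤ zero = ε
⟶*-numeralℤ-evalℤ (app t) = gmap app appC (⟶*-numeralℤ-evalℤ t) ◅◅ app-numeralℤ (evalℤ t)
⟶*-numeralℤ-evalℤ (neg t) = gmap neg negC (⟶*-numeralℤ-evalℤ t) ◅◅ neg-numeralℤ (evalℤ t)
⟶*-numeralℤ-evalℤ (t ⊕ u) = ⊕-cong* (⟶*-numeralℤ-evalℤ t) (⟶*-numeralℤ-evalℤ u) ◅◅ numeralℤ-+ (evalℤ t) (evalℤ u)
⟶*-numeralℤ-evalℤ (t ⊗ u) = ⊗-cong* (⟶*-numeralℤ-evalℤ t) (⟶*-numeralℤ-evalℤ u) ◅◅ numeralℤ-* (evalℤ t) (evalℤ u)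

theorem3p2p1 : GroundComplete N × GroundComplete Z
theorem3p2p1 =
  ( stronglyTerminating N
  , groundConfluent-by-evaluation evalℕ numeral evalℕ-step ⟶*-numeral-evalℕ )
  , ( stronglyTerminating Z
    , groundConfluent-by-evaluation evalℤ numeralℤ evalℤ-step ⟶*-numeralℤ-evalℤ )
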